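{- For the $n$-dimensional hypercube $Q_n$ with $n\geq 3$, $SSPC_{2U}(Q_n)\leq 2^{n-2}$.
   Context: $Q_n$ has vertex set $\{0,1\}^n$, two vertices adjacent iff they differ in exactly one coordinate. For a graph $G$ with distance $d$, a set $S\subseteq V(G)$ is a $2$-strong shortest path union cover if one can choose, for each $u\in S$ and each $v\in V(G)$ with $d(u,v)\leq 2$, a single shortest $u$–$v$ path $P(u,v)$ such that the union of the edge sets of all chosen paths equals $E(G)$; $SSPC_{2U}(G)$ is the minimum cardinality of such a set. -}

module Defs where

open import Data.Nat using (ℕ; zero; suc; _<_; _≤_; _∸_; _^_)
open import Data.Bool using (Bool)
open import Data.Fin using (Fin)
open import Data.Vec using (Vec; lookup)
open import Data.List using (List; length)
open import Data.List.Membership.Propositional using (_∈_)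
open import Data.List.Relation.Unary.Unique.Propositional using (Unique)
open import Data.Product using (Σ; ∃; ∃-syntax; _×_; _,_)
open import Data.Sum using (_⊎_)
open import Relation.Nullary using (¬_)
open import Relation.Binary.PropositionalEquality using (_≡_; _≢_)

module Graph {V : Set} (Adj : V → V → Set) where

  data Walk : V → V → ℕ → Set where
    here : ∀ {x} → Walk x x zero
    step : ∀ {x y z m} → Adj x y → Walk y z m → Walk x z (suc m)

  Dist≤ : V → V → ℕ → Set
  Dist≤ u v k = ∃[ m ] (m ≤ k × Walk u v m)

  -- A shortest u–v path: a walk of length m with no u–v walk shorter
  -- than m (such a walk is automatically a path, of length d(u,v)).
  ShortestPath : V → V → Set
  ShortestPath u v =
    Σ ℕ λ m → Walk u v m × (∀ m' → m' < m → ¬ Walk u v m')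

  data EdgeOf (a b : V) : ∀ {x y m} → Walk x y m → Set where
    hereF : ∀ {z m} (e : Adj a b) (w : Walk b z m) → EdgeOf a b (step e w)
    hereB : ∀ {z m} (e : Adj b a) (w : Walk a z m) → EdgeOf a b (step e w)
    there : ∀ {x y z m} (e : Adj x y) {w : Walk y z m}
          → EdgeOf a b w → EdgeOf a b (step e w)

  -- S is a 2-strong shortest path union cover: a choice of a single
  -- shortest path P(u,v) for each pair (u,v) (only pairs with u ∈ S and
  -- d(u,v) ≤ 2 are used) such that the union of the edge sets of the
  -- paths P(u,v), u ∈ S, d(u,v) ≤ 2, is all of E(G).  (Every path edge is
  -- an edge of G, so only the inclusion E(G) ⊆ union needs stating.)
  Is2SSPCUnion : List V → Set
  Is2SSPCUnion S =
    Σ ((u v : V) → ShortestPath u v) λ P →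
      ∀ a b → Adj a b →
        ∃[ u ] ∃[ v ] (u ∈ S × Dist≤ u v 2 ×
          (let (_ , w , _) = P u v in EdgeOf a b w))

  SSPC2U≤ : ℕ → Set
  SSPC2U≤ k = Σ (List V) λ S → Unique S × Is2SSPCUnion S × length S ≤ k

QVertex : ℕ → Set
QVertex n = Vec Bool n

QAdj : (n : ℕ) → QVertex n → QVertex n → Set
QAdj n u v = ∃[ i ] (lookup u i ≢ lookup v i ×
                     (∀ (j : Fin n) → j ≢ i → lookup u j ≡ lookup v j))

-- Call S ⊆ Q_k a route cover if every vertex is within distance 1 of S and
-- shortest routes from S to the vertices at distance ≤ 2 cover every edge.
-- Then {0,1} × S is a route cover of Q_(k+1): route from (b,u) to (b',y) along
-- the route from u to y and flip the new coordinate last. Old edges are covered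
-- by lifted routes, and a new edge (b,y)–(¬b,y) is the last edge of the route
-- from (b,u) to (¬b,y), where u ∈ S is within distance 1 of y. The perfect code
-- {000,111} of Q_3 is a route cover, and doubling it n-3 times gives one of size
-- 2^(n-2) in Q_n.
module Submission where

open import Defs
open import Data.Bool using (Bool; true; false; not)
open import Data.Bool.Properties using (not-¬; ¬-not)
open import Data.Empty using (⊥; ⊥-elim)
open import Data.Fin using (zero; suc)
open import Data.Fin.Properties using (suc-injective)
open import Data.List using (List; []; _∷_; _++_; map; length)
open import Data.List.Membership.Propositional using (_∈_)
open import Data.List.Membership.Propositional.Properties
  using (∈-++⁺ˡ; ∈-++⁺ʳ; ∈-map⁺; ∈-map⁻)
open import Data.List.Properties using (length-++; length-map)
open import Data.List.Relation.Unary.All using ([]; _∷_)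
open import Data.List.Relation.Unary.AllPairs using ([]; _∷_)
open import Data.List.Relation.Unary.Any using (here; there)
open import Data.List.Relation.Unary.Unique.Propositional using (Unique)
import Data.List.Relation.Unary.Unique.Propositional.Properties as Unique
open import Data.Nat using (ℕ; zero; suc; _+_; _*_; _∸_; _^_; _≤_; _≤?_; z≤n; s≤s)
open import Data.Nat.Properties
  using (≤-refl; ≤-reflexive; ≤-trans; <⇒≱; +-suc; +-identityʳ; +-monoˡ-≤; +-monoʳ-≤; *-monoʳ-≤)
open import Data.Product using (∃-syntax; _×_; _,_)
open import Data.Vec using ([]; _∷_; lookup)
open import Data.Vec.Properties using (∷-injectiveʳ; tabulate∘lookup; tabulate-cong)
open import Function using (_∘_)
open import Relation.Nullary.Decidable using (True; toWitness)
open import Relation.Binary.PropositionalEquality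

module _ {n : ℕ} where
  open Graph (QAdj n) public

infix 4 _~_

data _~_ : ∀ {n} → QVertex n → QVertex n → Set where
  flip-head : ∀ {n} x (t : QVertex n) → x ∷ t ~ not x ∷ t
  in-tail   : ∀ {n} x {s t : QVertex n} → s ~ t → x ∷ s ~ x ∷ t

lookup-injective : ∀ {n} (s t : QVertex n) → (∀ j → lookup s j ≡ lookup t j) → s ≡ t
lookup-injective s t s≗t =
  trans (sym (tabulate∘lookup s)) (trans (tabulate-cong s≗t) (tabulate∘lookup t))

~⇒QAdj : ∀ {n} {s t : QVertex n} → s ~ t → QAdj n s t
~⇒QAdj (flip-head x t) = zero , not-¬ refl , λ { zero 0≢0 → ⊥-elim (0≢0 refl) ; (suc j) _ → refl }
~⇒QAdj (in-tail x e) with ~⇒QAdj e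
... | i , differ , agree = suc i , differ , λ { zero _ → refl ; (suc j) j≢i → agree j (j≢i ∘ cong suc) }

QAdj⇒~ : ∀ {n} {s t : QVertex n} → QAdj n s t → s ~ t
QAdj⇒~ {s = x ∷ s} {y ∷ t} (zero , differ , agree)
  rewrite ¬-not (differ ∘ sym) | lookup-injective s t (λ j → agree (suc j) λ ())
  = flip-head x t
QAdj⇒~ {s = x ∷ s} {y ∷ t} (suc i , differ , agree)
  rewrite agree zero (λ ())
  = in-tail y (QAdj⇒~ (i , differ , λ j j≢i → agree (suc j) (j≢i ∘ suc-injective)))

diff : Bool → Bool → ℕ
diff false false = 0
diff false true  = 1
diff true  false = 1
diff true  true  = 0

-- The first coordinate is summed last, so that the routes built by extendRoutes
-- have length ham definitionally.
ham : ∀ {n} → QVertex n → QVertex n → ℕ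
ham []      []      = 0
ham (x ∷ s) (y ∷ t) = ham s t + diff x y

diff-self : ∀ x → diff x x ≡ 0
diff-self false = refl
diff-self true  = refl

diff-not : ∀ x → diff x (not x) ≡ 1
diff-not false = refl
diff-not true  = refl

diff≤suc-diff-not : ∀ x z → diff x z ≤ suc (diff (not x) z)
diff≤suc-diff-not false false = z≤n
diff≤suc-diff-not false true  = s≤s z≤n
diff≤suc-diff-not true  false = s≤s z≤n
diff≤suc-diff-not true  true  = z≤n

ham-self : ∀ {n} (s : QVertex n) → ham s s ≡ 0
ham-self []      = refl
ham-self (x ∷ s) = trans (cong (_+ diff x x) (ham-self s)) (diff-self x)

ham-∷-same : ∀ {n} x (s t : QVertex n) → ham (x ∷ s) (x ∷ t) ≡ ham s t
ham-∷-same x s t = trans (cong (ham s t +_) (diff-self x)) (+-identityʳ (ham s t))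

ham-~ : ∀ {n} {s t : QVertex n} (v : QVertex n) → s ~ t → ham s v ≤ suc (ham t v)
ham-~ (z ∷ v) (flip-head x t) =
  ≤-trans (+-monoʳ-≤ (ham t v) (diff≤suc-diff-not x z)) (≤-reflexive (+-suc (ham t v) _))
ham-~ (z ∷ v) (in-tail x e) = +-monoˡ-≤ (diff x z) (ham-~ v e)

ham≤length : ∀ {n} {u v : QVertex n} {m} → Walk u v m → ham u v ≤ m
ham≤length {u = u} here = ≤-reflexive (ham-self u)
ham≤length {u = u} {v} (step {y = y} e w) =
  ≤-trans (ham-~ v (QAdj⇒~ {s = u} {y} e)) (s≤s (ham≤length w))

Routes : ℕ → Set
Routes n = (u v : QVertex n) → Walk u v (ham u v)

step~ : ∀ {n} {s t v : QVertex n} {m} → s ~ t → Walk t v m → Walk s v (suc m)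
step~ {s = s} {t} e = step (~⇒QAdj {s = s} {t} e)

route⇒shortest : ∀ {n} {u v : QVertex n} → Walk u v (ham u v) → ShortestPath u v
route⇒shortest {u = u} {v} w = ham u v , w , λ m m<ham w′ → <⇒≱ m<ham (ham≤length w′)

infixr 5 _++ʷ_

_++ʷ_ : ∀ {n} {u v w : QVertex n} {m k} → Walk u v m → Walk v w k → Walk u w (m + k)
here     ++ʷ w′ = w′
step e w ++ʷ w′ = step e (w ++ʷ w′)

EdgeOf-++ˡ : ∀ {n} {a b u v w : QVertex n} {m k} {p : Walk u v m} (q : Walk v w k) →
             EdgeOf a b p → EdgeOf a b (p ++ʷ q)
EdgeOf-++ˡ q (hereF e p)   = hereF e (p ++ʷ q)
EdgeOf-++ˡ q (hereB e p)   = hereB e (p ++ʷ q)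
EdgeOf-++ˡ q (there e a∈p) = there e (EdgeOf-++ˡ q a∈p)

EdgeOf-++ʳ : ∀ {n} {a b u v w : QVertex n} {m k} (p : Walk u v m) {q : Walk v w k} →
             EdgeOf a b q → EdgeOf a b (p ++ʷ q)
EdgeOf-++ʳ here       a∈q = a∈q
EdgeOf-++ʳ (step e p) a∈q = there e (EdgeOf-++ʳ p a∈q)

module _ {n : ℕ} where

  liftWalk : ∀ x {s t : QVertex n} {m} → Walk s t m → Walk (x ∷ s) (x ∷ t) m
  liftWalk x here       = here
  liftWalk x (step e w) = step~ (in-tail x (QAdj⇒~ e)) (liftWalk x w)

  EdgeOf-lift : ∀ x {a b s t : QVertex n} {m} {w : Walk s t m} →
                EdgeOf a b w → EdgeOf (x ∷ a) (x ∷ b) (liftWalk x w)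
  EdgeOf-lift x (hereF e w)   = hereF _ _
  EdgeOf-lift x (hereB e w)   = hereB _ _
  EdgeOf-lift x (there e a∈w) = there _ (EdgeOf-lift x a∈w)

  headWalk : ∀ b b′ (y : QVertex n) → Walk (b ∷ y) (b′ ∷ y) (diff b b′)
  headWalk false false y = here
  headWalk false true  y = step~ (flip-head false y) here
  headWalk true  false y = step~ (flip-head true y) here
  headWalk true  true  y = here

  EdgeOf-headWalk : ∀ b (y : QVertex n) → EdgeOf (b ∷ y) (not b ∷ y) (headWalk b (not b) y)
  EdgeOf-headWalk false y = hereF _ _
  EdgeOf-headWalk true  y = hereF _ _

  extendRoutes : Routes n → Routes (suc n)
  extendRoutes r (b ∷ x) (b′ ∷ y) = liftWalk b (r x y) ++ʷ headWalk b b′ y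

canonicalRoutes : ∀ n → Routes n
canonicalRoutes zero    [] [] = here
canonicalRoutes (suc n) = extendRoutes (canonicalRoutes n)

CoveredBy : ∀ {n} → List (QVertex n) → Routes n → QVertex n → QVertex n → Set
CoveredBy S r a b = ∃[ u ] ∃[ v ] (u ∈ S × ham u v ≤ 2 × EdgeOf a b (r u v))

record RouteCover (n k : ℕ) : Set where
  field
    centres    : List (QVertex n)
    routes     : Routes n
    unique     : Unique centres
    size       : length centres ≤ k
    dominating : ∀ x → ∃[ u ] (u ∈ centres × ham u x ≤ 1)
    covering   : ∀ {a b} → a ~ b → CoveredBy centres routes a b

RouteCover⇒SSPC2U≤ : ∀ {n k} → RouteCover n k → Graph.SSPC2U≤ (QAdj n) k
RouteCover⇒SSPC2U≤ {n} C =
  centres , unique , ((λ u v → route⇒shortest (routes u v)) , cover) , size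
  where
  open RouteCover C
  cover : ∀ a b → QAdj n a b →
          ∃[ u ] ∃[ v ] (u ∈ centres × Dist≤ u v 2 × EdgeOf a b (routes u v))
  cover a b adj =
    let u , v , u∈S , near , a∈r = covering (QAdj⇒~ adj)
    in u , v , u∈S , (ham u v , near , routes u v) , a∈r

module _ {n : ℕ} where

  prependBits : List (QVertex n) → List (QVertex (suc n))
  prependBits S = map (false ∷_) S ++ map (true ∷_) S

  ∈-prependBits : ∀ {S u} x → u ∈ S → x ∷ u ∈ prependBits S
  ∈-prependBits     false u∈S = ∈-++⁺ˡ (∈-map⁺ (false ∷_) u∈S)
  ∈-prependBits {S} true  u∈S = ∈-++⁺ʳ (map (false ∷_) S) (∈-map⁺ (true ∷_) u∈S)

  prependBits-unique : ∀ {S} → Unique S → Unique (prependBits S)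
  prependBits-unique {S} uS =
    Unique.++⁺ (Unique.map⁺ ∷-injectiveʳ uS) (Unique.map⁺ ∷-injectiveʳ uS) disjoint
    where
    disjoint : ∀ {v} → v ∈ map (false ∷_) S × v ∈ map (true ∷_) S → ⊥
    disjoint (p , q) with ∈-map⁻ (false ∷_) p | ∈-map⁻ (true ∷_) q
    ... | _ , _ , refl | _ , _ , ()

  length-prependBits : ∀ S → length (prependBits S) ≡ 2 * length S
  length-prependBits S = begin
    length (map (false ∷_) S ++ map (true ∷_) S)
      ≡⟨ length-++ (map (false ∷_) S) ⟩
    length (map (false ∷_) S) + length (map (true ∷_) S)
      ≡⟨ cong₂ _+_ (length-map (false ∷_) S) (length-map (true ∷_) S) ⟩
    length S + length S
      ≡⟨ cong (length S +_) (sym (+-identityʳ (length S))) ⟩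
    2 * length S ∎
    where open ≡-Reasoning

doubleCover : ∀ {n k} → RouteCover n k → RouteCover (suc n) (2 * k)
doubleCover C = record
  { centres    = prependBits centres
  ; routes     = extendRoutes routes
  ; unique     = prependBits-unique unique
  ; size       = ≤-trans (≤-reflexive (length-prependBits centres)) (*-monoʳ-≤ 2 size)
  ; dominating = dominating′
  ; covering   = covering′
  }
  where
  open RouteCover C

  dominating′ : ∀ x → ∃[ u ] (u ∈ prependBits centres × ham u x ≤ 1)
  dominating′ (b ∷ y) =
    let u , u∈S , near = dominating y
    in b ∷ u , ∈-prependBits b u∈S , subst (_≤ 1) (sym (ham-∷-same b u y)) near

  covering′ : ∀ {a b} → a ~ b → CoveredBy (prependBits centres) (extendRoutes routes) a b
  covering′ (flip-head b y) =
    let u , u∈S , near = dominating y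
    in b ∷ u , not b ∷ y , ∈-prependBits b u∈S
     , subst (λ d → ham u y + d ≤ 2) (sym (diff-not b)) (+-monoˡ-≤ 1 near)
     , EdgeOf-++ʳ (liftWalk b (routes u y)) (EdgeOf-headWalk b y)
  covering′ (in-tail x e) =
    let u , v , u∈S , near , a∈r = covering e
    in x ∷ u , x ∷ v , ∈-prependBits x u∈S
     , subst (_≤ 2) (sym (ham-∷-same x u v)) near
     , EdgeOf-++ˡ (headWalk x x v) (EdgeOf-lift x a∈r)

pattern O = false
pattern I = true
pattern OOO = O ∷ O ∷ O ∷ []
pattern IOO = I ∷ O ∷ O ∷ []
pattern OIO = O ∷ I ∷ O ∷ []
pattern OOI = O ∷ O ∷ I ∷ []
pattern IIO = I ∷ I ∷ O ∷ []
pattern IOI = I ∷ O ∷ I ∷ []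
pattern OII = O ∷ I ∷ I ∷ []
pattern III = I ∷ I ∷ I ∷ []

-- The canonical routes (last coordinate flipped first) from OOO and III cover
-- every edge except IOO–IOI and OIO–OII, so OOO → IOI and III → OIO are
-- rerouted through these two edges.
routes₃ : Routes 3
routes₃ OOO IOI = step~ (flip-head O (O ∷ O ∷ [])) (step~ (in-tail I (in-tail O (flip-head O []))) here)
routes₃ III OIO = step~ (flip-head I (I ∷ I ∷ [])) (step~ (in-tail O (in-tail I (flip-head I []))) here)
routes₃ u v = canonicalRoutes 3 u v

centres₃ : List (QVertex 3)
centres₃ = OOO ∷ III ∷ []

dominatedBy : ∀ u x → u ∈ centres₃ → {True (ham u x ≤? 1)} → ∃[ u ] (u ∈ centres₃ × ham u x ≤ 1)
dominatedBy u x u∈S {u~x} = u , u∈S , toWitness u~x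

dominating₃ : ∀ x → ∃[ u ] (u ∈ centres₃ × ham u x ≤ 1)
dominating₃ OOO = dominatedBy OOO OOO (here refl)
dominating₃ IOO = dominatedBy OOO IOO (here refl)
dominating₃ OIO = dominatedBy OOO OIO (here refl)
dominating₃ OOI = dominatedBy OOO OOI (here refl)
dominating₃ IIO = dominatedBy III IIO (there (here refl))
dominating₃ IOI = dominatedBy III IOI (there (here refl))
dominating₃ OII = dominatedBy III OII (there (here refl))
dominating₃ III = dominatedBy III III (there (here refl))

fromOOO : ∀ {a b} v → {True (ham OOO v ≤? 2)} → EdgeOf a b (routes₃ OOO v) → CoveredBy centres₃ routes₃ a b
fromOOO v {v-near} a∈r = OOO , v , here refl , toWitness v-near , a∈r

fromIII : ∀ {a b} v → {True (ham III v ≤? 2)} → EdgeOf a b (routes₃ III v) → CoveredBy centres₃ routes₃ a b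
fromIII v {v-near} a∈r = III , v , there (here refl) , toWitness v-near , a∈r

covering₃ : ∀ {a b} → a ~ b → CoveredBy centres₃ routes₃ a b
covering₃ (flip-head O (O ∷ O ∷ [])) = fromOOO IOO (hereF _ _)
covering₃ (flip-head O (O ∷ I ∷ [])) = fromIII OOI (there _ (hereB _ _))
covering₃ (flip-head O (I ∷ O ∷ [])) = fromOOO IIO (there _ (hereF _ _))
covering₃ (flip-head O (I ∷ I ∷ [])) = fromIII OIO (hereB _ _)
covering₃ (flip-head I (O ∷ O ∷ [])) = fromOOO IOO (hereB _ _)
covering₃ (flip-head I (O ∷ I ∷ [])) = fromIII OOI (there _ (hereF _ _))
covering₃ (flip-head I (I ∷ O ∷ [])) = fromOOO IIO (there _ (hereB _ _))
covering₃ (flip-head I (I ∷ I ∷ [])) = fromIII OIO (hereF _ _)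
covering₃ (in-tail O (flip-head O (O ∷ []))) = fromOOO OIO (hereF _ _)
covering₃ (in-tail O (flip-head O (I ∷ []))) = fromOOO OII (there _ (hereF _ _))
covering₃ (in-tail O (flip-head I (O ∷ []))) = fromOOO OIO (hereB _ _)
covering₃ (in-tail O (flip-head I (I ∷ []))) = fromOOO OII (there _ (hereB _ _))
covering₃ (in-tail I (flip-head O (O ∷ []))) = fromIII IOO (there _ (hereB _ _))
covering₃ (in-tail I (flip-head O (I ∷ []))) = fromIII OOI (hereB _ _)
covering₃ (in-tail I (flip-head I (O ∷ []))) = fromIII IOO (there _ (hereF _ _))
covering₃ (in-tail I (flip-head I (I ∷ []))) = fromIII OOI (hereF _ _)
covering₃ (in-tail O (in-tail O (flip-head O []))) = fromOOO OOI (hereF _ _)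
covering₃ (in-tail O (in-tail O (flip-head I []))) = fromOOO OOI (hereB _ _)
covering₃ (in-tail O (in-tail I (flip-head O []))) = fromIII OIO (there _ (hereB _ _))
covering₃ (in-tail O (in-tail I (flip-head I []))) = fromIII OIO (there _ (hereF _ _))
covering₃ (in-tail I (in-tail O (flip-head O []))) = fromOOO IOI (there _ (hereF _ _))
covering₃ (in-tail I (in-tail O (flip-head I []))) = fromOOO IOI (there _ (hereB _ _))
covering₃ (in-tail I (in-tail I (flip-head O []))) = fromIII IOO (hereB _ _)
covering₃ (in-tail I (in-tail I (flip-head I []))) = fromIII IOO (hereF _ _)

Q₃-cover : RouteCover 3 2
Q₃-cover = record
  { centres    = centres₃
  ; routes     = routes₃
  ; unique     = ((λ ()) ∷ []) ∷ [] ∷ []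
  ; size       = ≤-refl
  ; dominating = dominating₃
  ; covering   = covering₃
  }

hypercubeCover : ∀ m → RouteCover (3 + m) (2 ^ suc m)
hypercubeCover zero    = Q₃-cover
hypercubeCover (suc m) = doubleCover (hypercubeCover m)

mainTheorem14 : (n : ℕ) → 3 ≤ n → Graph.SSPC2U≤ (QAdj n) (2 ^ (n ∸ 2))
mainTheorem14 (suc (suc (suc m))) (s≤s (s≤s (s≤s _))) = RouteCover⇒SSPC2U≤ (hypercubeCover m)
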